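{- $\texttt{UNK}$ is unsaturated at most $1/2$ of the time.
   Context: Setting: online Serial-Parallel Scheduling on $p$ processors; task $\tau_i$ arrives at time $t_i$ with serial work $\sigma_i$ (serial job $\tau_i^{\circledcirc}$, at most one processor at a time) and parallel work $\pi_i$ (perfectly scalable parallel job $\tau_i^{\parallel}$). The scheduler $\texttt{UNK}$: whenever there are idle processors it takes any arrived, not-yet-started task $\tau_i$ and runs $\tau_i^{\circledcirc}$ if $\tau_i$ arrived more than $\sigma_i$ time ago, and runs $\tau_i^{\parallel}$ otherwise; each of the at most $p$ running serial jobs gets one processor, at most one parallel job runs at a time, and it receives all processors not used by serial jobs. $\texttt{UNK}$ is saturated at a time step if all $p$ processors are in use, unsaturated otherwise. It is assumed w.l.o.g.\ that $\texttt{UNK}$ always has at least one uncompleted task from the start of time until the last task completes, so "the time" refers to $\texttt{UNK}$'s completion time (= its awake time). -}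

module Defs where

open import Data.Nat using (ℕ; zero; suc; _+_; _*_; _∸_; _≤_; _<_; _<ᵇ_)
open import Data.Bool using (Bool; true; false; if_then_else_; _∧_; not; T)
open import Data.Fin using (Fin; _≟_)
open import Data.List using (List; map; allFin; upTo)
open import Data.Nat.ListAction using (sum)
open import Data.Product using (∃; _×_)
open import Relation.Nullary using (¬_; does)
open import Relation.Binary.PropositionalEquality using (_≡_)

-- Discrete-time model of Serial-Parallel Scheduling.
-- A task arrives at time step `arr`, has serial work `σ` and parallel work `π`.
record Task : Set where
  constructor task
  field
    arr : ℕ
    σ   : ℕ
    π   : ℕ
open Task public

-- Status of a task: not yet started, running its serial job (remaining work),
-- running its parallel job (remaining work), or completed.
data Status : Set where
  waiting : Status
  ser     : ℕ → Status
  par     : ℕ → Status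
  done    : Status

Config : ℕ → Set
Config n = Fin n → Status

finish : ℕ → (ℕ → Status) → Status
finish zero    _ = done
finish (suc r) f = f (suc r)

isSer : Status → Bool
isSer (ser _) = true
isSer _       = false

isPar : Status → Bool
isPar (par _) = true
isPar _       = false

count : ∀ {n} → (Status → Bool) → Config n → ℕ
count {n} P c = sum (map (λ i → if P (c i) then 1 else 0) (allFin n))

-- number of running serial jobs (each holds one processor)
nser : ∀ {n} → Config n → ℕ
nser c = count isSer c

-- there are idle processors: no parallel job running (it would take all
-- processors not used by serial jobs) and fewer than p serial jobs running.
-- This is exactly "unsaturated".
idle : ℕ → ∀ {n} → Config n → Bool
idle p c = (count isPar c <ᵇ 1) ∧ (nser c <ᵇ p)

Eligible : ∀ {n} → (Fin n → Task) → ℕ → Config n → Fin n → Set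
Eligible τ t c i = (c i ≡ waiting) × (arr (τ i) ≤ t)

-- UNK's rule: run the serial job if the task arrived more than σ time ago
-- (t - arr > σ), else the parallel job.
start : ∀ {n} → (Fin n → Task) → ℕ → Fin n → Config n → Config n
start τ t i c j =
  if does (j ≟ i)
  then (if (arr (τ i) + σ (τ i)) <ᵇ t
        then finish (σ (τ i)) ser
        else finish (π (τ i)) par)
  else c j

-- Dispatch phase at the beginning of step t: while there are idle processors
-- and some arrived, not-yet-started task, start ANY such task.
data Dispatch (p : ℕ) {n : ℕ} (τ : Fin n → Task) (t : ℕ) :
       Config n → Config n → Set where
  stop : ∀ {c} → ¬ (T (idle p c) × ∃ (Eligible τ t c)) → Dispatch p τ t c c
  go   : ∀ {c c'} (i : Fin n) → T (idle p c) → Eligible τ t c i →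
         Dispatch p τ t (start τ t i c) c' → Dispatch p τ t c c'

exec : ℕ → ∀ {n} → Config n → Config n
exec p c i with c i
... | waiting = waiting
... | done    = done
... | ser r   = finish (r ∸ 1) ser
... | par r   = finish (r ∸ (p ∸ nser c)) par

-- A run of UNK (any of its nondeterministic choices).
-- pre t  : configuration at the beginning of step t
-- post t : configuration during step t (after dispatching)
record Run (p n : ℕ) (τ : Fin n → Task) : Set where
  field
    pre  : ℕ → Config n
    post : ℕ → Config n
    init : ∀ i → pre 0 i ≡ waiting
    disp : ∀ t → Dispatch p τ t (pre t) (post t)
    next : ∀ t → pre (suc t) ≡ exec p (post t)
open Run public

unsatCount : ∀ {p n τ} → Run p n τ → ℕ → ℕ
unsatCount {p} R T₀ = sum (map (λ t → if idle p (post R t) then 1 else 0) (upTo T₀))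

{-# OPTIONS --safe #-}
-- If step t is unsaturated, the live task i that arrived by t cannot be waiting (dispatch
-- would have started it on an idle processor) nor running its parallel job (which would take
-- every free processor), so it runs its serial job.  That job was launched at some step s
-- after i had waited more than σᵢ steps, and it ends by s + σᵢ.  While i waited, every step
-- of [aᵢ, s) was saturated, and that run is longer than [s, t].  So every unsaturated step is
-- preceded by a strictly longer run of saturated steps, and strong induction on the length of
-- the prefix gives the bound.
module Submission where

open import Defs
open import Data.Nat using (ℕ; zero; suc; _+_; _*_; _∸_; _≤_; _<_; _<ᵇ_; z≤n; s≤s; s≤s⁻¹)
open import Data.Nat.Properties hiding (_≟_)
open import Data.Nat.Induction using (<-rec)
open import Data.Nat.ListAction using (sum)
open import Data.Nat.ListAction.Properties using (sum-++)
open import Data.Bool using (Bool; true; false; if_then_else_; T)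
open import Data.Bool.Properties using (T?; T-∧)
open import Data.Fin using (Fin; _≟_)
open import Data.List using (_∷_; _++_; [_]; map; upTo)
open import Data.List.Properties using (upTo-∷ʳ; map-++)
open import Data.List.Membership.Propositional using (_∈_)
open import Data.List.Membership.Propositional.Properties using (∈-map⁺; ∈-allFin)
open import Data.List.Relation.Unary.Any using (here; there)
open import Data.Product using (∃; _×_; _,_; proj₁; proj₂)
open import Data.Sum using (_⊎_; inj₁; inj₂)
open import Data.Unit using (tt)
open import Data.Empty using (⊥-elim)
open import Function.Bundles using (Equivalence)
open import Relation.Nullary using (¬_; yes; no)
open import Relation.Binary.PropositionalEquality
  using (_≡_; _≢_; refl; sym; trans; cong; cong-app; subst; module ≡-Reasoning)

indicator : Bool → ℕ
indicator b = if b then 1 else 0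

countTrue : (ℕ → Bool) → ℕ → ℕ
countTrue b N = sum (map (λ t → indicator (b t)) (upTo N))

indicator≤1 : ∀ x → indicator x ≤ 1
indicator≤1 true  = ≤-refl
indicator≤1 false = z≤n

¬T⇒indicator≡0 : ∀ {x} → ¬ T x → indicator x ≡ 0
¬T⇒indicator≡0 {true}  ¬x = ⊥-elim (¬x tt)
¬T⇒indicator≡0 {false} _  = refl

countTrue-suc : ∀ b k → countTrue b (suc k) ≡ countTrue b k + indicator (b k)
countTrue-suc b k = begin
  sum (map f (upTo (suc k)))       ≡⟨ cong (λ ts → sum (map f ts)) (upTo-∷ʳ k) ⟨
  sum (map f (upTo k ++ [ k ]))    ≡⟨ cong sum (map-++ f (upTo k) [ k ]) ⟩
  sum (map f (upTo k) ++ [ f k ])  ≡⟨ sum-++ (map f (upTo k)) [ f k ] ⟩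
  countTrue b k + (f k + 0)        ≡⟨ cong (countTrue b k +_) (+-identityʳ (f k)) ⟩
  countTrue b k + f k              ∎
  where
  open ≡-Reasoning
  f : ℕ → ℕ
  f t = indicator (b t)

countTrue-+-≤ : ∀ b a k → countTrue b (k + a) ≤ countTrue b a + k
countTrue-+-≤ b a zero    = ≤-reflexive (sym (+-identityʳ _))
countTrue-+-≤ b a (suc k) = begin
  countTrue b (suc (k + a))                     ≡⟨ countTrue-suc b (k + a) ⟩
  countTrue b (k + a) + indicator (b (k + a))  ≤⟨ +-mono-≤ (countTrue-+-≤ b a k) (indicator≤1 _) ⟩
  countTrue b a + k + 1                         ≡⟨ +-assoc (countTrue b a) k 1 ⟩
  countTrue b a + (k + 1)                       ≡⟨ cong (countTrue b a +_) (+-comm k 1) ⟩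
  countTrue b a + suc k                         ∎
  where open ≤-Reasoning

countTrue-+-false : ∀ b a k → (∀ v → a ≤ v → v < k + a → ¬ T (b v)) →
  countTrue b (k + a) ≡ countTrue b a
countTrue-+-false b a zero    _     = refl
countTrue-+-false b a (suc k) all-false = begin
  countTrue b (suc (k + a))                     ≡⟨ countTrue-suc b (k + a) ⟩
  countTrue b (k + a) + indicator (b (k + a))  ≡⟨ cong (countTrue b (k + a) +_) last-false ⟩
  countTrue b (k + a) + 0                       ≡⟨ +-identityʳ _ ⟩
  countTrue b (k + a)                           ≡⟨ countTrue-+-false b a k earlier-false ⟩
  countTrue b a                                 ∎
  where
  open ≡-Reasoning
  last-false : indicator (b (k + a)) ≡ 0
  last-false = ¬T⇒indicator≡0 (all-false (k + a) (m≤n+m a k) ≤-refl)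
  earlier-false : ∀ v → a ≤ v → v < k + a → ¬ T (b v)
  earlier-false v a≤v v<k+a = all-false v a≤v (m<n⇒m<1+n v<k+a)

record FalseRunBefore (b : ℕ → Bool) (t : ℕ) : Set where
  field
    lo hi    : ℕ
    lo<hi    : lo < hi
    hi≤1+t   : hi ≤ suc t
    shorter  : suc t ∸ hi < hi ∸ lo
    false-on : ∀ v → lo ≤ v → v < hi → ¬ T (b v)

countTrue-compensated : ∀ b t (run : FalseRunBefore b t) →
  let open FalseRunBefore run in
  2 * countTrue b lo ≤ lo → 2 * countTrue b (suc t) ≤ suc t
countTrue-compensated b t run bound-lo = begin
  2 * countTrue b (suc t)             ≡⟨ cong (λ m → 2 * countTrue b m) gap+hi≡1+t ⟨
  2 * countTrue b (gap + hi)          ≤⟨ *-monoʳ-≤ 2 (countTrue-+-≤ b hi gap) ⟩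
  2 * (countTrue b hi + gap)          ≡⟨ cong (λ m → 2 * (countTrue b m + gap)) len+lo≡hi ⟨
  2 * (countTrue b (len + lo) + gap)  ≡⟨ cong (λ m → 2 * (m + gap)) (countTrue-+-false b lo len false′) ⟩
  2 * (countTrue b lo + gap)          ≡⟨ *-distribˡ-+ 2 (countTrue b lo) gap ⟩
  2 * countTrue b lo + 2 * gap        ≤⟨ +-mono-≤ bound-lo (+-monoʳ-≤ gap gap+0≤len) ⟩
  lo + (gap + len)                    ≡⟨ trans (+-comm lo (gap + len)) (+-assoc gap len lo) ⟩
  gap + (len + lo)                    ≡⟨ cong (gap +_) len+lo≡hi ⟩
  gap + hi                            ≡⟨ gap+hi≡1+t ⟩
  suc t                               ∎
  where
  open ≤-Reasoning
  open FalseRunBefore run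
  gap len : ℕ
  gap = suc t ∸ hi
  len = hi ∸ lo
  gap+hi≡1+t : gap + hi ≡ suc t
  gap+hi≡1+t = m∸n+n≡m hi≤1+t
  len+lo≡hi : len + lo ≡ hi
  len+lo≡hi = m∸n+n≡m (<⇒≤ lo<hi)
  gap+0≤len : gap + 0 ≤ len
  gap+0≤len = ≤-trans (≤-reflexive (+-identityʳ gap)) (<⇒≤ shorter)
  false′ : ∀ v → lo ≤ v → v < len + lo → ¬ T (b v)
  false′ v lo≤v v<len+lo = false-on v lo≤v (subst (v <_) len+lo≡hi v<len+lo)

twice-countTrue-≤ : ∀ b N → (∀ t → t < N → T (b t) → FalseRunBefore b t) →
  2 * countTrue b N ≤ N
twice-countTrue-≤ b N compensated = <-rec P bound N ≤-refl
  where
  P : ℕ → Set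
  P M = M ≤ N → 2 * countTrue b M ≤ M
  bound : ∀ M → (∀ {K} → K < M → P K) → P M
  bound zero    _  _   = z≤n
  bound (suc t) ih t<N with T? (b t)
  ... | yes bt = countTrue-compensated b t run (ih lo<1+t (≤-trans (<⇒≤ lo<1+t) t<N))
    where
    run : FalseRunBefore b t
    run = compensated t t<N bt
    open FalseRunBefore run
    lo<1+t : lo < suc t
    lo<1+t = <-≤-trans lo<hi hi≤1+t
  ... | no ¬bt = begin
    2 * countTrue b (suc t)                    ≡⟨ cong (2 *_) (countTrue-suc b t) ⟩
    2 * (countTrue b t + indicator (b t))      ≡⟨ cong (λ m → 2 * (countTrue b t + m)) (¬T⇒indicator≡0 ¬bt) ⟩
    2 * (countTrue b t + 0)                    ≡⟨ cong (2 *_) (+-identityʳ (countTrue b t)) ⟩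
    2 * countTrue b t                          ≤⟨ ih ≤-refl (<⇒≤ t<N) ⟩
    t                                          <⟨ ≤-refl ⟩
    suc t                                      ∎
    where open ≤-Reasoning

∈⇒≤sum : ∀ {m ms} → m ∈ ms → m ≤ sum ms
∈⇒≤sum             (here refl)  = m≤m+n _ _
∈⇒≤sum {ms = k ∷ _} (there m∈ms) = ≤-trans (∈⇒≤sum m∈ms) (m≤n+m _ k)

running-parallel⇒¬idle : ∀ p {n} (c : Config n) i {r} → c i ≡ par r → ¬ T (idle p c)
running-parallel⇒¬idle p c i c[i]≡par idle-c = <⇒≱ no-parallel one-parallel
  where
  no-parallel : count isPar c < 1
  no-parallel = <ᵇ⇒< (count isPar c) 1 (proj₁ (Equivalence.to T-∧ idle-c))
  one-parallel : 1 ≤ count isPar c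
  one-parallel = subst (λ st → indicator (isPar st) ≤ count isPar c) c[i]≡par
    (∈⇒≤sum (∈-map⁺ (λ j → indicator (isPar (c j))) (∈-allFin i)))

launch : Task → ℕ → Status
launch x t = if arr x + σ x <ᵇ t then finish (σ x) ser else finish (π x) par

data Launched (x : Task) (s u : ℕ) : Status → Set where
  finished : Launched x s u done
  parallel : ∀ r → Launched x s u (par r)
  serial   : ∀ r → arr x + σ x < s → suc r + u ≡ s + σ x → Launched x s u (ser (suc r))

Launched⇒≢waiting : ∀ {x s u st} → Launched x s u st → st ≢ waiting
Launched⇒≢waiting finished       ()
Launched⇒≢waiting (parallel _)   ()
Launched⇒≢waiting (serial _ _ _) ()

finish-parallel : ∀ {x s u} w → Launched x s u (finish w par)
finish-parallel zero    = finished
finish-parallel (suc r) = parallel (suc r)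

finish-serial : ∀ {x s u} w → arr x + σ x < s → w + u ≡ s + σ x → Launched x s u (finish w ser)
finish-serial zero    _      _  = finished
finish-serial (suc r) waited eq = serial r waited eq

launch-Launched : ∀ x t → Launched x t t (launch x t)
launch-Launched x t with arr x + σ x <ᵇ t in waited
... | true  = finish-serial (σ x) (<ᵇ⇒< _ _ (subst T (sym waited) tt)) (+-comm (σ x) t)
... | false = finish-parallel (π x)

exec-Launched : ∀ p {n} (c : Config n) i {x s u} →
  Launched x s u (c i) → Launched x s (suc u) (exec p c i)
exec-Launched p c i l with c i | l
... | done         | finished           = finished
... | par r        | parallel .r        = finish-parallel (r ∸ (p ∸ nser c))
... | ser .(suc r) | serial r waited eq = finish-serial r waited (trans (+-suc r _) eq)

exec-waiting : ∀ p {n} (c : Config n) i → c i ≡ waiting → exec p c i ≡ waiting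
exec-waiting p c i c[i]≡waiting rewrite c[i]≡waiting = refl

Launched⇒serial : ∀ {x s u st} → Launched x s u st → st ≢ done → (∀ r → st ≢ par r) →
  arr x + σ x < s × u < s + σ x
Launched⇒serial finished                 alive _         = ⊥-elim (alive refl)
Launched⇒serial (parallel r)             _     ¬parallel = ⊥-elim (¬parallel r refl)
Launched⇒serial {u = u} (serial r waited eq) _ _         = waited , subst (u <_) eq (s≤s (m≤n+m u r))

start-self : ∀ {n} (τ : Fin n → Task) t i (c : Config n) → start τ t i c i ≡ launch (τ i) t
start-self τ t i c with i ≟ i
... | yes _   = refl
... | no i≢i = ⊥-elim (i≢i refl)

start-other : ∀ {n} (τ : Fin n → Task) t {i j} (c : Config n) → j ≢ i → start τ t i c j ≡ c j
start-other τ t {i} {j} c j≢i with j ≟ i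
... | yes j≡i = ⊥-elim (j≢i j≡i)
... | no _    = refl

module _ {p n : ℕ} {τ : Fin n → Task} {t : ℕ} where

  Dispatch-stuck : ∀ {c c'} → Dispatch p τ t c c' → ¬ (T (idle p c') × ∃ (Eligible τ t c'))
  Dispatch-stuck (stop stuck) = stuck
  Dispatch-stuck (go _ _ _ d) = Dispatch-stuck d

  Dispatch-keeps : ∀ {c c'} i → Dispatch p τ t c c' → c i ≢ waiting → c' i ≡ c i
  Dispatch-keeps i (stop _) _ = refl
  Dispatch-keeps {c} i (go j _ (c[j]≡waiting , _) d) c[i]≢waiting =
    trans (Dispatch-keeps i d (subst (_≢ waiting) (sym untouched) c[i]≢waiting)) untouched
    where
    untouched : start τ t j c i ≡ c i
    untouched = start-other τ t c (λ { refl → c[i]≢waiting c[j]≡waiting })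

  Dispatch-waiting : ∀ {c c'} i → Dispatch p τ t c c' → c i ≡ waiting →
    c' i ≡ waiting ⊎ c' i ≡ launch (τ i) t
  Dispatch-waiting i (stop _) c[i]≡waiting = inj₁ c[i]≡waiting
  Dispatch-waiting {c} i (go j _ _ d) c[i]≡waiting with i ≟ j
  ... | yes refl = inj₂ (trans (Dispatch-keeps i d launched) (start-self τ t i c))
    where
    launched : start τ t i c i ≢ waiting
    launched = subst (_≢ waiting) (sym (start-self τ t i c)) (Launched⇒≢waiting (launch-Launched (τ i) t))
  ... | no i≢j = Dispatch-waiting i d (trans (start-other τ t c i≢j) c[i]≡waiting)

module _ {p n : ℕ} {τ : Fin n → Task} (R : Run p n τ) (i : Fin n) where

  WaitingUpTo : ℕ → Set
  WaitingUpTo u = ∀ v → v ≤ u → post R v i ≡ waiting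

  record LaunchedBy (u : ℕ) : Set where
    field
      step           : ℕ
      step≤u         : step ≤ u
      waiting-before : ∀ v → v < step → post R v i ≡ waiting
      status         : Launched (τ i) step u (post R u i)

  pre-suc : ∀ u → pre R (suc u) i ≡ exec p (post R u) i
  pre-suc u = cong-app (next R u) i

  dispatch-waiting : ∀ u → (∀ v → v < u → post R v i ≡ waiting) → pre R u i ≡ waiting →
    WaitingUpTo u ⊎ LaunchedBy u
  dispatch-waiting u waited pre≡waiting with Dispatch-waiting i (disp R u) pre≡waiting
  ... | inj₁ post≡waiting = inj₁ λ v v≤u → case (m≤n⇒m<n∨m≡n v≤u)
    where
    case : ∀ {v} → v < u ⊎ v ≡ u → post R v i ≡ waiting
    case (inj₁ v<u)  = waited _ v<u
    case (inj₂ refl) = post≡waiting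
  ... | inj₂ post≡launch = inj₂ record
    { step           = u
    ; step≤u         = ≤-refl
    ; waiting-before = waited
    ; status         = subst (Launched (τ i) u u) (sym post≡launch) (launch-Launched (τ i) u)
    }

  LaunchedBy-suc : ∀ {u} → LaunchedBy u → LaunchedBy (suc u)
  LaunchedBy-suc {u} launched = record
    { step           = step
    ; step≤u         = m≤n⇒m≤1+n step≤u
    ; waiting-before = waiting-before
    ; status         = subst (Launched (τ i) step (suc u)) (sym kept) status-pre
    }
    where
    open LaunchedBy launched
    status-pre : Launched (τ i) step (suc u) (pre R (suc u) i)
    status-pre = subst (Launched (τ i) step (suc u)) (sym (pre-suc u)) (exec-Launched p (post R u) i status)
    kept : post R (suc u) i ≡ pre R (suc u) i
    kept = Dispatch-keeps i (disp R (suc u)) (Launched⇒≢waiting status-pre)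

  history : ∀ u → WaitingUpTo u ⊎ LaunchedBy u
  history zero = dispatch-waiting 0 (λ _ ()) (init R i)
  history (suc u) with history u
  ... | inj₂ launched = inj₂ (LaunchedBy-suc launched)
  ... | inj₁ waited   = dispatch-waiting (suc u) (λ v v<1+u → waited v (s≤s⁻¹ v<1+u))
    (trans (pre-suc u) (exec-waiting p (post R u) i (waited u ≤-refl)))

unsaturated⇒FalseRunBefore : ∀ {p n τ} (R : Run p n τ) t i → arr (τ i) ≤ t → post R t i ≢ done →
  T (idle p (post R t)) → FalseRunBefore (λ v → idle p (post R v)) t
unsaturated⇒FalseRunBefore {p} {τ = τ} R t i arrived alive unsaturated with history R i t
... | inj₁ waited = ⊥-elim (Dispatch-stuck (disp R t) (unsaturated , i , waited t ≤-refl , arrived))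
... | inj₂ launched = record
  { lo       = a
  ; hi       = step
  ; lo<hi    = ≤-<-trans (m≤m+n a (σ (τ i))) waited-long
  ; hi≤1+t   = m≤n⇒m≤1+n step≤u
  ; shorter  = ≤-<-trans (m≤n+o⇒m∸n≤o (suc t) step ends) waited-more-than-σ
  ; false-on = λ v a≤v v<step idle-v →
      Dispatch-stuck (disp R v) (idle-v , i , waiting-before v v<step , a≤v)
  }
  where
  open LaunchedBy launched
  a : ℕ
  a = arr (τ i)
  serial-bounds : a + σ (τ i) < step × t < step + σ (τ i)
  serial-bounds = Launched⇒serial status alive
    (λ r running-parallel → running-parallel⇒¬idle p (post R t) i running-parallel unsaturated)
  waited-long : a + σ (τ i) < step
  waited-long = proj₁ serial-bounds
  ends : suc t ≤ step + σ (τ i)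
  ends = proj₂ serial-bounds
  waited-more-than-σ : σ (τ i) < step ∸ a
  waited-more-than-σ = subst (_< step ∸ a) (m+n∸m≡n a (σ (τ i))) (∸-monoˡ-< waited-long (m≤m+n a (σ (τ i))))

lemma5p2 : (p n : ℕ) → 1 ≤ p → (τ : Fin n → Task) → (R : Run p n τ) →
    (Tend : ℕ) →
    (∀ i → pre R Tend i ≡ done) →
    (∀ t → t < Tend → ∃ λ i → (arr (τ i) ≤ t) × (post R t i ≢ done)) →
    2 * unsatCount R Tend ≤ Tend
lemma5p2 p n _ τ R Tend _ live = twice-countTrue-≤ (λ t → idle p (post R t)) Tend compensated
  where
  compensated : ∀ t → t < Tend → T (idle p (post R t)) → FalseRunBefore (λ v → idle p (post R v)) t
  compensated t t<Tend with live t t<Tend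
  ... | i , arrived , alive = unsaturated⇒FalseRunBefore R t i arrived alive
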